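{- If $G$ is an EOCD graph with empty $P-D$, then $\gamma_t(G)=2\gamma(G)$.
   Context: Graphs are finite and simple. $\gamma(G)$ is the domination number (minimum size of $S\subseteq V(G)$ such that every vertex outside $S$ has a neighbor in $S$) and $\gamma_t(G)$ is the total domination number (minimum size of $S$ such that every vertex of $G$ has a neighbor in $S$). A set $P$ is an ECD set if the closed neighborhoods $N[v]$, $v\in P$, partition $V(G)$; a set $D$ is an EOD set if the open neighborhoods $N(v)$, $v\in D$, partition $V(G)$. $G$ is an EOCD graph with empty $P-D$ if there exist an ECD set $P$ and an EOD set $D$ of $G$ with $P\subseteq D$. -}

module Defs where

open import Data.Nat using (ℕ; _≤_)
open import Data.Fin using (Fin)
open import Data.Fin.Subset using (Subset; _∈_; _⊆_; ∣_∣)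
open import Data.Product using (Σ; ∃; _×_; _,_)
open import Data.Sum using (_⊎_)
open import Relation.Nullary using (¬_; Dec)
open import Relation.Binary.PropositionalEquality using (_≡_)

record Graph (n : ℕ) : Set₁ where
  field
    Adj     : Fin n → Fin n → Set
    sym     : ∀ {u v} → Adj u v → Adj v u
    irrefl  : ∀ {v} → ¬ Adj v v
    adj?    : ∀ u v → Dec (Adj u v)
open Graph public

module _ {n : ℕ} (G : Graph n) where

  InOpenNbhd : Fin n → Fin n → Set
  InOpenNbhd u v = Adj G v u

  InClosedNbhd : Fin n → Fin n → Set
  InClosedNbhd u v = u ≡ v ⊎ Adj G v u

  ExactlyOneIn : Subset n → (Fin n → Set) → Set
  ExactlyOneIn S R = Σ (Fin n) λ x → (x ∈ S × R x) × (∀ y → y ∈ S → R y → y ≡ x)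

  IsDominating : Subset n → Set
  IsDominating S = ∀ u → ¬ (u ∈ S) → Σ (Fin n) λ v → v ∈ S × Adj G u v

  IsTotalDominating : Subset n → Set
  IsTotalDominating S = ∀ u → Σ (Fin n) λ v → v ∈ S × Adj G u v

  IsDominationNumber : ℕ → Set
  IsDominationNumber k =
    (Σ (Subset n) λ S → IsDominating S × ∣ S ∣ ≡ k) ×
    (∀ S → IsDominating S → k ≤ ∣ S ∣)

  IsTotalDominationNumber : ℕ → Set
  IsTotalDominationNumber k =
    (Σ (Subset n) λ S → IsTotalDominating S × ∣ S ∣ ≡ k) ×
    (∀ S → IsTotalDominating S → k ≤ ∣ S ∣)

  -- ECD set: the closed neighbourhoods N[v], v ∈ P, partition V(G)
  -- (each vertex lies in exactly one of them; they are automatically nonempty)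
  IsECD : Subset n → Set
  IsECD P = ∀ u → ExactlyOneIn P (InClosedNbhd u)

  IsEOD : Subset n → Set
  IsEOD D = ∀ u → ExactlyOneIn D (InOpenNbhd u)

  IsEOCDEmptyPminusD : Set
  IsEOCDEmptyPminusD = Σ (Subset n) λ P → Σ (Subset n) λ D → IsECD P × IsEOD D × P ⊆ D

-- Every comparison of sizes is made by one counting principle: if f maps a
-- set A onto a set B, then |B| ≤ |A| (`onto-card`).  Sending a vertex to the
-- unique element of P whose closed neighbourhood contains it maps every
-- dominating set onto P, so an ECD set is a minimum dominating set and
-- γ(G) = |P|.  Likewise, sending a vertex to the unique element of D whose
-- open neighbourhood contains it maps every total dominating set onto D, so
-- γ_t(G) = |D|.  Finally, when P ⊆ D this second map sends P onto D − P and
-- D − P onto P, hence |D| = |P| + |D − P| = 2 |P|.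
module Submission where

open import Defs hiding (sym)
open import Data.Nat using (ℕ; _*_; _+_; suc; _≤_; _<_; z≤n; s≤s)
open import Data.Nat.Properties using (≤-antisym; +-suc; +-identityʳ; module ≤-Reasoning)
open import Data.Nat.Induction using (<-wellFounded)
open import Induction.WellFounded using (Acc; acc)
open import Data.Fin using (Fin)
open import Data.Fin.Subset using (Subset; _∈_; _∉_; _⊆_; ∣_∣; _─_; _-_; ⁅_⁆; inside; outside)
open import Data.Fin.Subset.Properties
  using (_∈?_; drop-∷-⊆; p─q⊆p; x∈p∧x∉q⇒x∈p─q; x∈p∧x≢y⇒x∈p-y; x∈⁅x⁆; x∈⁅y⁆⇒x≡y; ∣⁅x⁆∣≡1;
         x∈p⇒∣p-x∣<∣p∣; nonempty?; Empty-unique; ∣⊥∣≡0)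
open import Data.Vec using (_∷_; []; here; there)
open import Data.Product using (Σ; _×_; _,_; proj₁; proj₂)
open import Data.Sum using (inj₁; inj₂)
open import Data.Empty using (⊥-elim)
open import Relation.Nullary using (yes; no)
open import Relation.Binary.PropositionalEquality
  using (_≡_; _≢_; refl; sym; trans; cong; subst; module ≡-Reasoning)

x∈p─q⇒x∉q : ∀ {n} {x : Fin n} (p q : Subset n) → x ∈ p ─ q → x ∉ q
x∈p─q⇒x∉q (_ ∷ p) (outside ∷ q) here      ()
x∈p─q⇒x∉q (_ ∷ p) (_ ∷ q)       (there m) (there m′) = x∈p─q⇒x∉q p q m m′

card-split : ∀ {n} (p q : Subset n) → q ⊆ p → ∣ p ∣ ≡ ∣ q ∣ + ∣ p ─ q ∣
card-split []            []            _   = refl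
card-split (outside ∷ p) (outside ∷ q) q⊆p = card-split p q (drop-∷-⊆ q⊆p)
card-split (inside ∷ p)  (inside ∷ q)  q⊆p = cong suc (card-split p q (drop-∷-⊆ q⊆p))
card-split (inside ∷ p)  (outside ∷ q) q⊆p =
  trans (cong suc (card-split p q (drop-∷-⊆ q⊆p))) (sym (+-suc ∣ q ∣ ∣ p ─ q ∣))
card-split (outside ∷ p) (inside ∷ q)  q⊆p with q⊆p here
... | ()

card-remove : ∀ {n} {x : Fin n} {p : Subset n} → x ∈ p → ∣ p ∣ ≡ suc ∣ p - x ∣
card-remove {x = x} {p} x∈p =
  trans (card-split p ⁅ x ⁆ ⁅x⁆⊆p) (cong (_+ ∣ p - x ∣) (∣⁅x⁆∣≡1 x))
  where
  ⁅x⁆⊆p : ⁅ x ⁆ ⊆ p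
  ⁅x⁆⊆p y∈⁅x⁆ = subst (_∈ p) (sym (x∈⁅y⁆⇒x≡y x y∈⁅x⁆)) x∈p

Onto : ∀ {n} → (Fin n → Fin n) → Subset n → Subset n → Set
Onto {n} f A B = ∀ b → b ∈ B → Σ (Fin n) λ a → a ∈ A × f a ≡ b

-- If f a ≡ b, then f still maps A - a onto B - b: the preimages chosen for
-- the other elements of B are different from a.
onto-remove : ∀ {n} {f : Fin n → Fin n} {A B : Subset n} {a b : Fin n} →
              f a ≡ b → Onto f A B → Onto f (A - a) (B - b)
onto-remove {f = f} {A} {B} {a} {b} fa≡b onto b′ b′∈B-b
  with onto b′ (p─q⊆p B ⁅ b ⁆ b′∈B-b)
... | a′ , a′∈A , fa′≡b′ = a′ , x∈p∧x≢y⇒x∈p-y a′∈A a′≢a , fa′≡b′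
  where
  a′≢a : a′ ≢ a
  a′≢a a′≡a = x∈p─q⇒x∉q B ⁅ b ⁆ b′∈B-b
    (subst (_∈ ⁅ b ⁆) (trans (sym fa≡b) (trans (cong f (sym a′≡a)) fa′≡b′)) (x∈⁅x⁆ b))

-- A set is at least as large as any set it maps onto.  By well-founded
-- recursion on |A|: remove a point of B together with a preimage of it.
onto-card : ∀ {n} (f : Fin n → Fin n) (A B : Subset n) → Onto f A B → ∣ B ∣ ≤ ∣ A ∣
onto-card {n} f A B = go A B (<-wellFounded ∣ A ∣)
  where
  go : ∀ A B → Acc _<_ ∣ A ∣ → Onto f A B → ∣ B ∣ ≤ ∣ A ∣
  go A B (acc rs) onto with nonempty? B
  ... | no B-empty = subst (_≤ ∣ A ∣) (sym (trans (cong ∣_∣ (Empty-unique B-empty)) (∣⊥∣≡0 n))) z≤n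
  ... | yes (b , b∈B) with onto b b∈B
  ... | a , a∈A , fa≡b = begin
    ∣ B ∣          ≡⟨ card-remove b∈B ⟩
    suc ∣ B - b ∣  ≤⟨ s≤s (go (A - a) (B - b) (rs (x∈p⇒∣p-x∣<∣p∣ a∈A)) (onto-remove fa≡b onto)) ⟩
    suc ∣ A - a ∣  ≡⟨ sym (card-remove a∈A) ⟩
    ∣ A ∣          ∎
    where open ≤-Reasoning

-- k is the least size of a set with property Q, and it is attained.
-- γ(G) and γ_t(G) are instances: IsDominationNumber G k unfolds to
-- IsMinimumSize (IsDominating G) k, and similarly for total domination.
IsMinimumSize : ∀ {n} → (Subset n → Set) → ℕ → Set
IsMinimumSize {n} Q k = (Σ (Subset n) λ S → Q S × ∣ S ∣ ≡ k) × (∀ S → Q S → k ≤ ∣ S ∣)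

minimum-size-unique : ∀ {n} {Q : Subset n → Set} {k m : ℕ} →
                      IsMinimumSize Q k → IsMinimumSize Q m → k ≡ m
minimum-size-unique ((S , QS , ∣S∣≡k) , k-min) ((T , QT , ∣T∣≡m) , m-min) =
  ≤-antisym (subst (_ ≤_) ∣T∣≡m (k-min T QT)) (subst (_ ≤_) ∣S∣≡k (m-min S QS))

minimum-by-onto : ∀ {n} {Q : Subset n → Set} (f : Fin n → Fin n) (S : Subset n) →
                  Q S → (∀ T → Q T → Onto f T S) → IsMinimumSize Q ∣ S ∣
minimum-by-onto f S QS onto = (S , QS , refl) , λ T QT → onto-card f T S (onto T QT)

module _ {n : ℕ} (G : Graph n) where

  module ECD {P : Subset n} (ecd : IsECD G P) where

    owner : Fin n → Fin n
    owner u = proj₁ (ecd u)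

    owner-unique : ∀ {u p} → p ∈ P → InClosedNbhd G u p → p ≡ owner u
    owner-unique {u} {p} = proj₂ (proj₂ (ecd u)) p

    owner-self : ∀ {p} → p ∈ P → owner p ≡ p
    owner-self p∈P = sym (owner-unique p∈P (inj₁ refl))

    dominating : IsDominating G P
    dominating u u∉P with ecd u
    ... | p , (p∈P , inj₁ u≡p) , _ = ⊥-elim (u∉P (subst (_∈ P) (sym u≡p) p∈P))
    ... | p , (p∈P , inj₂ p~u) , _ = p , p∈P , Graph.sym G p~u

    -- Each p ∈ P lies in S or has a neighbour in S, and that vertex is owned by p.
    dominating-onto : ∀ S → IsDominating G S → Onto owner S P
    dominating-onto S S-dom p p∈P with p ∈? S
    ... | yes p∈S = p , p∈S , owner-self p∈P
    ... | no p∉S with S-dom p p∉S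
    ... | s , s∈S , p~s = s , s∈S , sym (owner-unique p∈P (inj₂ p~s))

    minimum : IsDominationNumber G ∣ P ∣
    minimum = minimum-by-onto owner P dominating dominating-onto

  module EOD {D : Subset n} (eod : IsEOD G D) where

    owner : Fin n → Fin n
    owner u = proj₁ (eod u)

    owner-unique : ∀ {u d} → d ∈ D → InOpenNbhd G u d → d ≡ owner u
    owner-unique {u} {d} = proj₂ (proj₂ (eod u)) d

    owner-∈ : ∀ u → owner u ∈ D
    owner-∈ u = proj₁ (proj₁ (proj₂ (eod u)))

    owner-adj : ∀ u → Adj G (owner u) u
    owner-adj u = proj₂ (proj₁ (proj₂ (eod u)))

    total-dominating : IsTotalDominating G D
    total-dominating u = owner u , owner-∈ u , Graph.sym G (owner-adj u)

    -- Each d ∈ D has a neighbour in S, and that neighbour is owned by d.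
    total-dominating-onto : ∀ S → IsTotalDominating G S → Onto owner S D
    total-dominating-onto S S-tot d d∈D with S-tot d
    ... | s , s∈S , d~s = s , s∈S , sym (owner-unique d∈D d~s)

    minimum : IsTotalDominationNumber G ∣ D ∣
    minimum = minimum-by-onto owner D total-dominating total-dominating-onto

  module Nested {P D : Subset n} (ecd : IsECD G P) (eod : IsEOD G D) (P⊆D : P ⊆ D) where

    -- A vertex q ∈ D ─ P is not in P, so its P-owner p is a neighbour of q;
    -- since q ∈ D, q is the D-owner of p.
    P-onto-D─P : Onto (EOD.owner eod) P (D ─ P)
    P-onto-D─P q q∈D─P with ecd q
    ... | p , (p∈P , inj₁ q≡p) , _ =
      ⊥-elim (x∈p─q⇒x∉q D P q∈D─P (subst (_∈ P) (sym q≡p) p∈P))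
    ... | p , (p∈P , inj₂ p~q) , _ =
      p , p∈P , sym (EOD.owner-unique eod (p─q⊆p D P q∈D─P) (Graph.sym G p~q))

    -- The D-owner d of p ∈ P is not in P: otherwise d and p both own p in the
    -- partition by closed neighbourhoods, so d = p would be adjacent to itself.
    D-owner-∉ : ∀ {p} → p ∈ P → EOD.owner eod p ∉ P
    D-owner-∉ {p} p∈P d∈P = Graph.irrefl G (subst (λ v → Adj G v p) d≡p d~p)
      where
      d~p : Adj G (EOD.owner eod p) p
      d~p = EOD.owner-adj eod p
      d≡p : EOD.owner eod p ≡ p
      d≡p = trans (ECD.owner-unique ecd d∈P (inj₂ d~p)) (ECD.owner-self ecd p∈P)

    -- p ∈ P is the D-owner of its own D-owner, which lies in D ─ P.
    D─P-onto-P : Onto (EOD.owner eod) (D ─ P) P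
    D─P-onto-P p p∈P =
      d , x∈p∧x∉q⇒x∈p─q (EOD.owner-∈ eod p) (D-owner-∉ p∈P) ,
      sym (EOD.owner-unique eod (P⊆D p∈P) (Graph.sym G (EOD.owner-adj eod p)))
      where
      d : Fin n
      d = EOD.owner eod p

    size : ∣ D ∣ ≡ 2 * ∣ P ∣
    size = begin
      ∣ D ∣                 ≡⟨ card-split D P P⊆D ⟩
      ∣ P ∣ + ∣ D ─ P ∣     ≡⟨ cong (∣ P ∣ +_) ∣D─P∣≡∣P∣ ⟩
      ∣ P ∣ + ∣ P ∣         ≡⟨ cong (∣ P ∣ +_) (sym (+-identityʳ ∣ P ∣)) ⟩
      2 * ∣ P ∣             ∎
      where
      open ≡-Reasoning
      ∣D─P∣≡∣P∣ : ∣ D ─ P ∣ ≡ ∣ P ∣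
      ∣D─P∣≡∣P∣ = ≤-antisym (onto-card _ P (D ─ P) P-onto-D─P)
                            (onto-card _ (D ─ P) P D─P-onto-P)

proposition2p4 : {n : ℕ} (G : Graph n) → IsEOCDEmptyPminusD G →
    (g t : ℕ) → IsDominationNumber G g → IsTotalDominationNumber G t → t ≡ 2 * g
proposition2p4 G (P , D , ecd , eod , P⊆D) g t γ≡g γₜ≡t = begin
  t          ≡⟨ minimum-size-unique γₜ≡t (EOD.minimum G eod) ⟩
  ∣ D ∣      ≡⟨ Nested.size G ecd eod P⊆D ⟩
  2 * ∣ P ∣  ≡⟨ cong (2 *_) (minimum-size-unique (ECD.minimum G ecd) γ≡g) ⟩
  2 * g      ∎
  where open ≡-Reasoning
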